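{- Let $\Sigma$ be an $X$-symmetric graph with valency $\mathrm v\ge2$ and let $\tau\in V(\Sigma)$. If there exists an $X_\tau$-flag-transitive $1$-$(\mathrm v,\kappa,\rho)$ design $\mathfrak D(\tau)$ on the point set $\Sigma(\tau)$ with $1\le\kappa\le\mathrm v-1$ such that $\rho/m(\mathfrak D(\tau))$ is odd, then there exists a self-paired $X$-symmetric orbit $\Theta$ on $DSt^\kappa(\Sigma)$.
   Context: Graphs are finite, simple, undirected; $\Sigma$ is $X$-symmetric if $X$ acts on $V(\Sigma)$ preserving adjacency and transitively on vertices and arcs; $X_\tau$ is the vertex stabiliser and $X_S$ the setwise stabiliser. A $1$-$(\mathrm v,\kappa,\rho)$ design on $\Sigma(\tau)$ is an incidence structure with point set $\Sigma(\tau)$ (of size $\mathrm v$) and a set of blocks, each block incident with exactly $\kappa$ points and each point with exactly $\rho$ blocks; it is $X_\tau$-flag-transitive if $X_\tau$ acts on it (naturally on points, and on blocks) preserving incidence and transitively on incident point-block pairs (flags). The trace of a block is the set of points incident with it; $m(\mathfrak D(\tau))$, the multiplicity, is the (constant) number of blocks with a given trace. For $S\subseteq\Sigma(\tau)$ with $|S|=\kappa$, the $\kappa$-star is $\mathfrak s(\tau,S)=\{(\tau,\sigma):\sigma\in S\}$; it is symmetric if $X_\tau\cap X_S$ is transitive on $S$; a set of stars is $X$-symmetric if it is a single $X$-orbit containing a symmetric star. A $\kappa$-double star is a pair $(\mathfrak l,\mathfrak r)$ of $\kappa$-stars $\mathfrak l=\mathfrak s(\tau,L)$, $\mathfrak r=\mathfrak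 s(\sigma,R)$ with $\sigma\in L$ and $\tau\in R$; $DSt^\kappa(\Sigma)$ is the set of them. An $X$-orbit $\Theta$ on $DSt^\kappa(\Sigma)$ is $X$-symmetric if $\{\mathfrak l,\mathfrak r:(\mathfrak l,\mathfrak r)\in\Theta\}$ is $X$-symmetric, and self-paired if $(\mathfrak l,\mathfrak r)\in\Theta$ implies $(\mathfrak r,\mathfrak l)\in\Theta$. -}

module Defs where

open import Level using (Level; _⊔_) renaming (zero to lzero)
open import Algebra.Bundles using (Group)
open import Data.Nat using (ℕ; suc; _*_)
open import Data.Bool using (Bool; true; false)
open import Data.Fin using (Fin)
open import Data.Fin.Subset using (Subset; _∈_; _⊆_; ∣_∣)
open import Data.Fin.Subset.Properties using (_∈?_)
open import Data.Vec using (Vec; tabulate; lookup)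
open import Data.Vec.Properties using (≡-dec)
import Data.Bool.Properties as BoolP
open import Data.Product using (Σ; ∃; _×_; _,_)
open import Data.Sum using (_⊎_)
open import Relation.Nullary using (does)
open import Relation.Binary.PropositionalEquality using (_≡_)

Odd : ℕ → Set
Odd k = ∃ λ j → k ≡ suc (2 * j)

record Graph (n : ℕ) : Set where
  field
    adj     : Fin n → Fin n → Bool
    irrefl  : ∀ x → adj x x ≡ false
    sym     : ∀ x y → adj x y ≡ adj y x

  nbhd : Fin n → Subset n
  nbhd x = tabulate (adj x)

  HasValency : ℕ → Set
  HasValency v = ∀ x → ∣ nbhd x ∣ ≡ v

record Action {c ℓ : Level} (X : Group c ℓ) (A : Set) : Set (c ⊔ ℓ) where
  open Group X
  field
    act      : Carrier → A → A
    act-cong : ∀ {g h} → g ≈ h → ∀ a → act g a ≡ act h a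
    act-ε    : ∀ a → act ε a ≡ a
    act-∙    : ∀ g h a → act (g ∙ h) a ≡ act g (act h a)

module _ {c ℓ : Level} {n : ℕ} {X : Group c ℓ} (α : Action X (Fin n)) where
  open Group X
  open Action α

  -- induced action on subsets: g·S = { g x : x ∈ S }
  img : Carrier → Subset n → Subset n
  img g S = tabulate (λ y → lookup S (act (g ⁻¹) y))

record IsSymmetric {c ℓ : Level} {n : ℕ} (Γ : Graph n) (X : Group c ℓ)
                   (α : Action X (Fin n)) : Set (c ⊔ ℓ) where
  open Graph Γ
  open Group X
  open Action α
  field
    preserves-adj : ∀ g x y → adj (act g x) (act g y) ≡ adj x y
    vertex-trans  : ∀ x y → ∃ λ g → act g x ≡ y
    arc-trans     : ∀ x y z w → adj x y ≡ true → adj z w ≡ true →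
                    ∃ λ g → act g x ≡ z × act g y ≡ w

-- Blocks form the finite set Fin b; `inc B` is the set of points
-- incident with the block B (its trace), so incidence is σ ∈ inc B.
-- Repeated blocks (same trace) are allowed.
record FlagTransDesign {c ℓ : Level} {n : ℕ} (Γ : Graph n) (X : Group c ℓ)
                       (α : Action X (Fin n)) (τ : Fin n)
                       (v κ ρ : ℕ) : Set (c ⊔ ℓ) where
  open Graph Γ
  open Group X
  open Action α
  field
    b          : ℕ
    inc        : Fin b → Subset n
    points     : ∣ nbhd τ ∣ ≡ v
    on-points  : ∀ B → inc B ⊆ nbhd τ
    block-size : ∀ B → ∣ inc B ∣ ≡ κ
    replication : ∀ σ → σ ∈ nbhd τ →
                  ∣ tabulate {n = b} (λ B → does (σ ∈? inc B)) ∣ ≡ ρ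
    bact       : (g : Carrier) → act g τ ≡ τ → Fin b → Fin b
    bact-cong  : ∀ {g h} (p : act g τ ≡ τ) (q : act h τ ≡ τ) → g ≈ h →
                 ∀ B → bact g p B ≡ bact h q B
    bact-ε     : ∀ (p : act ε τ ≡ τ) B → bact ε p B ≡ B
    bact-∙     : ∀ g h (p : act (g ∙ h) τ ≡ τ) (q : act g τ ≡ τ)
                   (r : act h τ ≡ τ) B →
                 bact (g ∙ h) p B ≡ bact g q (bact h r B)
    bact-inc   : ∀ g (p : act g τ ≡ τ) σ B → σ ∈ inc B →
                 act g σ ∈ inc (bact g p B)
    flag-trans : ∀ σ B σ' B' → σ ∈ inc B → σ' ∈ inc B' →
                 ∃ λ g → Σ (act g τ ≡ τ) λ p →
                   act g σ ≡ σ' × bact g p B ≡ B'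

  multiplicityAt : Fin b → ℕ
  multiplicityAt B =
    ∣ tabulate {n = b} (λ B' → does (≡-dec BoolP._≟_ (inc B') (inc B))) ∣

  HasMultiplicity : ℕ → Set
  HasMultiplicity m = ∀ B → multiplicityAt B ≡ m

record Star (n : ℕ) : Set where
  constructor star
  field
    centre : Fin n
    leaves : Subset n

module _ {n : ℕ} (Γ : Graph n) where
  open Graph Γ

  IsKStar : ℕ → Star n → Set
  IsKStar κ (star τ S) = S ⊆ nbhd τ × ∣ S ∣ ≡ κ

record DoubleStar (n : ℕ) : Set where
  constructor dstar
  field
    left  : Star n
    right : Star n

swapDS : ∀ {n} → DoubleStar n → DoubleStar n
swapDS (dstar l r) = dstar r l

module _ {n : ℕ} (Γ : Graph n) where

  IsKDoubleStar : ℕ → DoubleStar n → Set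
  IsKDoubleStar κ (dstar l r) =
    IsKStar Γ κ l × IsKStar Γ κ r ×
    Star.centre r ∈ Star.leaves l × Star.centre l ∈ Star.leaves r

module _ {c ℓ : Level} {n : ℕ} {X : Group c ℓ} (α : Action X (Fin n)) where
  open Group X
  open Action α

  starAct : Carrier → Star n → Star n
  starAct g (star τ S) = star (act g τ) (img α g S)

  dsAct : Carrier → DoubleStar n → DoubleStar n
  dsAct g (dstar l r) = dstar (starAct g l) (starAct g r)

  IsSymmetricStar : Star n → Set c
  IsSymmetricStar (star τ S) =
    ∀ x y → x ∈ S → y ∈ S →
    ∃ λ g → act g τ ≡ τ × img α g S ≡ S × act g x ≡ y

  IsXSymmetricStarSet : (Star n → Set c) → Set c
  IsXSymmetricStarSet P =
    (∀ s → P s → ∀ g → P (starAct g s)) ×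
    (∀ s s' → P s → P s' → ∃ λ g → starAct g s ≡ s') ×
    (∃ λ s → P s × IsSymmetricStar s)

  InOrbit : DoubleStar n → DoubleStar n → Set c
  InOrbit d₀ d = ∃ λ g → dsAct g d₀ ≡ d

  StarsOfOrbit : DoubleStar n → Star n → Set c
  StarsOfOrbit d₀ s = ∃ λ d → InOrbit d₀ d ×
    (s ≡ DoubleStar.left d ⊎ s ≡ DoubleStar.right d)

  IsSelfPairedOrbit : DoubleStar n → Set c
  IsSelfPairedOrbit d₀ = ∀ d → InOrbit d₀ d → InOrbit d₀ (swapDS d)

  IsXSymmetricOrbit : DoubleStar n → Set c
  IsXSymmetricOrbit d₀ = IsXSymmetricStarSet (StarsOfOrbit d₀)

module Submission where

-- Pick a neighbour σ of τ and g ∈ X exchanging τ and σ (arc-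
-- transitivity).  Then g ∙ g fixes τ and σ, so it permutes the ρ = k·m
-- blocks through σ and acts on their traces by L ↦ (g ∙ g) L.  Each trace
-- is carried by exactly m blocks, so as k is odd some orbit of this action
-- on traces has odd length c.  For a trace L = inc B through σ in it,
-- h = g ^ c still exchanges τ and σ while h ∙ h = (g ∙ g) ^ c fixes the
-- star s₀ = s(τ,L).  The double star (s₀, h s₀) is then a κ-double star
-- that h reverses, so its X-orbit is self-paired, its stars form the
-- single X-orbit of s₀, and s₀ is symmetric by flag-transitivity.

open import Defs
open import Level using (Level)
open import Algebra.Bundles using (Group)
open import Data.Nat using (ℕ; zero; suc; _+_; _*_; _∸_; _≤_; _<_; z≤n; s≤s; NonZero; >-nonZero; >-nonZero⁻¹)
open import Data.Nat.Properties
  using ( +-suc; +-assoc; +-identityʳ; *-suc; *-comm; +-∸-assoc; *-monoʳ-≤; *-mono-≤; *-distribˡ-∸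
        ; *-distribʳ-∸; *-cancelʳ-≤; _≤?_; ≤-refl; ≤-trans; ≤-reflexive; ≤-<-trans; ≰⇒>; 1+n≰n; <⇒≤; <⇒≱
        ; >⇒≢; n<1+n; m≤n+m; m+n∸n≡m; m<n⇒0<n∸m; m+[n∸m]≡n; m≤n⇒m<n∨m≡n; m∸n≤m; m≤n⇒m≤1+n; ∸-monoʳ-<
        ; +-0-commutativeMonoid)
open import Data.Nat.GeneralisedArithmetic using (fold; fold-+; fold-*)
open import Data.Nat.Induction using (<-rec)
open import Data.Bool using (Bool; true; false; _∧_; not)
open import Data.Bool.Properties using (∧-zeroʳ; ∧-identityʳ) renaming (_≟_ to _≟ᵇ_)
open import Data.Fin using (Fin; zero; suc; toℕ)
open import Data.Fin.Properties using (pigeonhole)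
open import Data.Fin.Permutation using (permutation)
open import Data.Fin.Subset using (∣_∣; _∈_; _⊆_)
open import Data.Fin.Subset.Properties using (nonempty?; Empty-unique; ∣⊥∣≡0; ⊆-antisym; _∈?_)
open import Data.Vec using (Vec; tabulate; lookup)
open import Data.Vec.Properties using (lookup∘tabulate; tabulate∘lookup; tabulate-cong; []=⇒lookup; lookup⇒[]=; ≡-dec)
open import Data.Product using (∃; _×_; _,_; proj₁; proj₂)
open import Data.Sum using (_⊎_; inj₁; inj₂) renaming (map to ⊎-map)
open import Function.Base using (_∘_)
open import Relation.Nullary using (¬_; yes; no; does; contradiction)
open import Relation.Binary.Definitions using (DecidableEquality)
open import Relation.Binary.PropositionalEquality
open import Algebra.Properties.CommutativeMonoid.Sum +-0-commutativeMonoid using (sum; sum-permute)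

indicator : Bool → ℕ
indicator true  = 1
indicator false = 0

count : ∀ {b} → (Fin b → Bool) → ℕ
count p = sum (λ i → indicator (p i))

count-cong : ∀ {b} {p q : Fin b → Bool} → (∀ i → p i ≡ q i) → count p ≡ count q
count-cong {zero}  _ = refl
count-cong {suc b} e = cong₂ _+_ (cong indicator (e zero)) (count-cong (e ∘ suc))

count-split : ∀ {b} (p q : Fin b → Bool) →
              count p ≡ count (λ i → p i ∧ not (q i)) + count (λ i → p i ∧ q i)
count-split {zero}  p q = refl
count-split {suc b} p q with p zero | q zero | count-split (p ∘ suc) (q ∘ suc)
... | true  | true  | ih = trans (cong suc ih) (sym (+-suc _ _))
... | true  | false | ih = cong suc ih
... | false | _     | ih = ih

count-nonzero : ∀ {b} (p : Fin b → Bool) → 1 ≤ count p → ∃ λ i → p i ≡ true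
count-nonzero {suc b} p pos with p zero in p₀
... | true  = zero , p₀
... | false = let i , pᵢ = count-nonzero (p ∘ suc) pos in suc i , pᵢ

count-permute : ∀ {b} (p : Fin b → Bool) (π π⁻¹ : Fin b → Fin b) →
                (∀ y → π (π⁻¹ y) ≡ y) → (∀ x → π⁻¹ (π x) ≡ x) →
                count (p ∘ π) ≡ count p
count-permute p π π⁻¹ l r = sym (sum-permute (indicator ∘ p) (permutation π π⁻¹ l r))

∣tabulate∣ : ∀ {b} (p : Fin b → Bool) → ∣ tabulate p ∣ ≡ count p
∣tabulate∣ {zero}  p = refl
∣tabulate∣ {suc b} p with p zero
... | true  = cong suc (∣tabulate∣ (p ∘ suc))
... | false = ∣tabulate∣ (p ∘ suc)

fold-injective : ∀ {A : Set} {f : A → A} → (∀ {x y} → f x ≡ f y → x ≡ y) →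
                 ∀ i {x y} → fold x f i ≡ fold y f i → x ≡ y
fold-injective f-inj zero    e = e
fold-injective f-inj (suc i) e = fold-injective f-inj i (f-inj e)

fold-cong : ∀ {A : Set} {f f′ : A → A} → (∀ x → f x ≡ f′ x) → ∀ x i → fold x f i ≡ fold x f′ i
fold-cong same x zero    = refl
fold-cong {f = f} same x (suc i) = trans (cong f (fold-cong same x i)) (same _)

fold-fixed : ∀ {A : Set} (f : A → A) {x} → f x ≡ x → ∀ i → fold x f i ≡ x
fold-fixed f fx zero    = refl
fold-fixed f fx (suc i) = trans (cong f (fold-fixed f fx i)) fx

fold-twice : ∀ {A : Set} (f : A → A) x j → fold x (f ∘ f) j ≡ fold (fold x f j) f j
fold-twice f x j = begin
  fold x (f ∘ f) j   ≡⟨ fold-* x f j ⟨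
  fold x f (j * 2)   ≡⟨ cong (fold x f) (trans (*-comm j 2) (cong (j +_) (+-identityʳ j))) ⟩
  fold x f (j + j)   ≡⟨ fold-+ x f j ⟩
  fold (fold x f j) f j ∎
  where open ≡-Reasoning

fold-odd-swap : ∀ {A : Set} (f : A → A) {x y} → f x ≡ y → f y ≡ x →
                ∀ c → Odd c → fold x f c ≡ y
fold-odd-swap f {x} fx fy c (j , refl) = begin
  f (fold x f (2 * j))   ≡⟨ cong (f ∘ fold x f) (*-comm 2 j) ⟩
  f (fold x f (j * 2))   ≡⟨ cong f (fold-* x f j) ⟩
  f (fold x (f ∘ f) j)   ≡⟨ cong f (fold-fixed (f ∘ f) (trans (cong f fx) fy) j) ⟩
  f x                    ≡⟨ fx ⟩
  _ ∎
  where open ≡-Reasoning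

Even : ℕ → Set
Even k = ∃ λ j → k ≡ 2 * j

even-or-odd : ∀ k → Even k ⊎ Odd k
even-or-odd zero = inj₁ (0 , refl)
even-or-odd (suc k) with even-or-odd k
... | inj₁ (j , refl) = inj₂ (j , refl)
... | inj₂ (j , refl) = inj₁ (suc j , sym (*-suc 2 j))

odd∸even : ∀ {k l} → Odd k → Even l → l ≤ k → Odd (k ∸ l)
odd∸even (j , refl) (e , refl) l≤k = j ∸ e , (begin
    suc (2 * j) ∸ 2 * e ≡⟨ +-∸-assoc 1 (*-monoʳ-≤ 2 e≤j) ⟩
    suc (2 * j ∸ 2 * e) ≡⟨ cong suc (*-distribˡ-∸ 2 j e) ⟨
    suc (2 * (j ∸ e))   ∎)
  where
  open ≡-Reasoning
  e≤j : e ≤ j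
  e≤j with e ≤? j
  ... | yes e≤j = e≤j
  ... | no  e≰j = contradiction
         (≤-trans (≤-trans (≤-reflexive (sym (*-suc 2 j))) (*-monoʳ-≤ 2 (≰⇒> e≰j))) l≤k)
         (1+n≰n {suc (2 * j)})

cancel-multiple : ∀ a l k m .{{_ : NonZero m}} → a + l * m ≡ k * m → l ≤ k × a ≡ (k ∸ l) * m
cancel-multiple a l k m e = *-cancelʳ-≤ l k m (subst (l * m ≤_) e (m≤n+m (l * m) a)) , (begin
  a                   ≡⟨ m+n∸n≡m a (l * m) ⟨
  a + l * m ∸ l * m   ≡⟨ cong (_∸ l * m) e ⟩
  k * m ∸ l * m       ≡⟨ *-distribʳ-∸ m k l ⟨
  (k ∸ l) * m         ∎)
  where open ≡-Reasoning

module OddOrbit {A : Set} (_≟_ : DecidableEquality A)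
                (Φ : A → A) (Φ-injective : ∀ {x y} → Φ x ≡ Φ y → x ≡ y)
                {b : ℕ} (tr : Fin b → A) (m : ℕ) .{{_ : NonZero m}} where

  withTrace : A → Fin b → Bool
  withTrace t B = does (tr B ≟ t)

  withTrace-≡ : ∀ t B → withTrace t B ≡ true → tr B ≡ t
  withTrace-≡ t B e with tr B ≟ t
  ... | yes p = p

  withTrace-≢ : ∀ t B → ¬ tr B ≡ t → withTrace t B ≡ false
  withTrace-≢ t B ne with tr B ≟ t
  ... | yes p = contradiction p ne
  ... | no  _ = refl

  Blocks : Set
  Blocks = Fin b → Bool

  Occurs : Blocks → A → Set
  Occurs U t = ∃ λ B → U B ≡ true × tr B ≡ t

  Uniform : Blocks → Set
  Uniform U = ∀ B → U B ≡ true → count (λ B' → U B' ∧ withTrace (tr B) B') ≡ m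

  Closed : Blocks → Set
  Closed U = ∀ B → U B ≡ true → Occurs U (Φ (tr B))

  orbit-occurs : ∀ {U t} → Closed U → Occurs U t → ∀ i → Occurs U (fold t Φ i)
  orbit-occurs clo occ zero = occ
  orbit-occurs clo occ (suc i) with B , inU , trB ← orbit-occurs clo occ i
    = subst (Occurs _ ∘ Φ) trB (clo B inU)

  -- Periods.  Since there are only b blocks, a trace of a closed set is
  -- periodic (pigeonhole), and so has a minimal period.

  MinimalPeriod : A → ℕ → Set
  MinimalPeriod t ℓ = 1 ≤ ℓ × fold t Φ ℓ ≡ t × (∀ i → 1 ≤ i → i < ℓ → ¬ fold t Φ i ≡ t)

  periodic : ∀ {U t} → Closed U → Occurs U t → ∃ λ d → 1 ≤ d × fold t Φ d ≡ t
  periodic {t = t} clo occ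
    with i , i' , i<i' , same ← pigeonhole (n<1+n b) (λ (i : Fin (suc b)) → proj₁ (orbit-occurs clo occ (toℕ i)))
    = toℕ i' ∸ toℕ i , m<n⇒0<n∸m i<i' , fold-injective Φ-injective (toℕ i) (begin
      fold (fold t Φ (toℕ i' ∸ toℕ i)) Φ (toℕ i) ≡⟨ fold-+ t Φ (toℕ i) ⟨
      fold t Φ (toℕ i + (toℕ i' ∸ toℕ i))         ≡⟨ cong (fold t Φ) (m+[n∸m]≡n (<⇒≤ i<i')) ⟩
      fold t Φ (toℕ i')                           ≡⟨ trace (toℕ i') ⟨
      tr (proj₁ (orbit-occurs clo occ (toℕ i')))  ≡⟨ cong tr same ⟨
      tr (proj₁ (orbit-occurs clo occ (toℕ i)))   ≡⟨ trace (toℕ i) ⟩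
      fold t Φ (toℕ i)                            ∎)
    where
    open ≡-Reasoning
    trace : ∀ j → tr (proj₁ (orbit-occurs clo occ j)) ≡ fold t Φ j
    trace j = proj₂ (proj₂ (orbit-occurs clo occ j))

  leastPeriodFrom : ∀ t s r → 1 ≤ s → (∀ i → 1 ≤ i → i < s → ¬ fold t Φ i ≡ t) →
                    fold t Φ (s + r) ≡ t → ∃ (MinimalPeriod t)
  leastPeriodFrom t s zero 1≤s below period =
    s , 1≤s , subst (λ z → fold t Φ z ≡ t) (+-identityʳ s) period , below
  leastPeriodFrom t s (suc r) 1≤s below period with fold t Φ s ≟ t
  ... | yes at-s = s , 1≤s , at-s , below
  ... | no  not-s = leastPeriodFrom t (suc s) r (s≤s z≤n) below′
                      (subst (λ z → fold t Φ z ≡ t) (+-suc s r) period)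
    where
    below′ : ∀ i → 1 ≤ i → i < suc s → ¬ fold t Φ i ≡ t
    below′ i 1≤i (s≤s i≤s) with m≤n⇒m<n∨m≡n i≤s
    ... | inj₁ i<s  = below i 1≤i i<s
    ... | inj₂ refl = not-s

  minimalPeriod : ∀ {U t} → Closed U → Occurs U t → ∃ (MinimalPeriod t)
  minimalPeriod {t = t} clo occ with d , 1≤d , period ← periodic clo occ =
    leastPeriodFrom t 1 (d ∸ 1) ≤-refl (λ i 1≤i i<1 → contradiction 1≤i (<⇒≱ i<1))
      (subst (λ z → fold t Φ z ≡ t) (sym (m+[n∸m]≡n 1≤d)) period)

  minimal-distinct : ∀ {t ℓ} → MinimalPeriod t ℓ → ∀ {i j} → j < i → i < ℓ →
                     ¬ fold t Φ i ≡ fold t Φ j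
  minimal-distinct {t} (_ , _ , least) {i} {j} j<i i<ℓ e =
    least (i ∸ j) (m<n⇒0<n∸m j<i) (≤-<-trans (m∸n≤m i j) i<ℓ)
      (fold-injective Φ-injective j (begin
        fold (fold t Φ (i ∸ j)) Φ j ≡⟨ fold-+ t Φ j ⟨
        fold t Φ (j + (i ∸ j))      ≡⟨ cong (fold t Φ) (m+[n∸m]≡n (<⇒≤ j<i)) ⟩
        fold t Φ i                  ≡⟨ e ⟩
        fold t Φ j                  ∎))
    where open ≡-Reasoning

  remove : A → Blocks → Blocks
  remove t U B = U B ∧ not (withTrace t B)

  remove-member : ∀ t U B → remove t U B ≡ true → U B ≡ true × ¬ tr B ≡ t
  remove-member t U B e with U B | tr B ≟ t
  ... | true  | no ne = refl , ne
  ... | true  | yes _ = contradiction e λ ()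
  ... | false | _     = contradiction e λ ()

  member-remove : ∀ t U B → U B ≡ true → ¬ tr B ≡ t → remove t U B ≡ true
  member-remove t U B inU ne rewrite inU | withTrace-≢ t B ne = refl

  remove-count : ∀ U B → Uniform U → U B ≡ true → count U ≡ count (remove (tr B) U) + m
  remove-count U B uni inU =
    trans (count-split U (withTrace (tr B))) (cong (count (remove (tr B) U) +_) (uni B inU))

  remove-uniform : ∀ t U → Uniform U → Uniform (remove t U)
  remove-uniform t U uni B inR = trans (count-cong sameClass) (uni B (proj₁ (remove-member t U B inR)))
    where
    sameClass : ∀ B' → remove t U B' ∧ withTrace (tr B) B' ≡ U B' ∧ withTrace (tr B) B'
    sameClass B' with withTrace (tr B) B' in w
    ... | false = trans (∧-zeroʳ _) (sym (∧-zeroʳ _))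
    ... | true  rewrite withTrace-≢ t B' (λ trB'≡t → proj₂ (remove-member t U B inR)
                                            (trans (sym (withTrace-≡ (tr B) B' w)) trB'≡t))
                = cong (_∧ true) (∧-identityʳ (U B'))

  removeOrbit : A → ℕ → Blocks → Blocks
  removeOrbit t zero    U = U
  removeOrbit t (suc r) U = remove (fold t Φ r) (removeOrbit t r U)

  AvoidsOrbit : A → ℕ → Fin b → Set
  AvoidsOrbit t r B = ∀ j → j < r → ¬ tr B ≡ fold t Φ j

  removeOrbit-member : ∀ t r U B → removeOrbit t r U B ≡ true → U B ≡ true × AvoidsOrbit t r B
  removeOrbit-member t zero    U B inR = inR , λ j ()
  removeOrbit-member t (suc r) U B inR
    with inR′ , not-r ← remove-member (fold t Φ r) (removeOrbit t r U) B inR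
    with inU , avoids ← removeOrbit-member t r U B inR′ = inU , avoids′
    where
    avoids′ : AvoidsOrbit t (suc r) B
    avoids′ j (s≤s j≤r) with m≤n⇒m<n∨m≡n j≤r
    ... | inj₁ j<r  = avoids j j<r
    ... | inj₂ refl = not-r

  member-removeOrbit : ∀ t r U B → U B ≡ true → AvoidsOrbit t r B → removeOrbit t r U B ≡ true
  member-removeOrbit t zero    U B inU avoids = inU
  member-removeOrbit t (suc r) U B inU avoids =
    member-remove (fold t Φ r) (removeOrbit t r U) B
      (member-removeOrbit t r U B inU (λ j j<r → avoids j (m≤n⇒m≤1+n j<r))) (avoids r ≤-refl)

  removeOrbit-count : ∀ t r U → Uniform U → (∀ i → i < r → Occurs (removeOrbit t i U) (fold t Φ i)) →
                      Uniform (removeOrbit t r U) × count U ≡ count (removeOrbit t r U) + r * m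
  removeOrbit-count t zero    U uni present = uni , sym (+-identityʳ (count U))
  removeOrbit-count t (suc r) U uni present
    with uni′ , size ← removeOrbit-count t r U uni (λ i i<r → present i (m≤n⇒m≤1+n i<r))
    with B , inR , trB ← present r ≤-refl
    = remove-uniform (fold t Φ r) R uni′ , (begin
      count U                                   ≡⟨ size ⟩
      count R + r * m                           ≡⟨ cong (_+ r * m) (remove-count R B uni′ inR) ⟩
      count (remove (tr B) R) + m + r * m       ≡⟨ cong (λ t′ → count (remove t′ R) + m + r * m) trB ⟩
      count (remove (fold t Φ r) R) + m + r * m ≡⟨ +-assoc _ m (r * m) ⟩
      count (remove (fold t Φ r) R) + suc r * m ∎)
    where
    open ≡-Reasoning
    R : Blocks
    R = removeOrbit t r U

  removeCycle : ∀ {U t ℓ} → Uniform U → Closed U → Occurs U t → MinimalPeriod t ℓ →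
                Uniform (removeOrbit t ℓ U) × Closed (removeOrbit t ℓ U) ×
                count U ≡ count (removeOrbit t ℓ U) + ℓ * m
  removeCycle {U} {t} {ℓ} uni clo occ minℓ@(1≤ℓ , period , _) =
    proj₁ counted , closed , proj₂ counted
    where
    counted : Uniform (removeOrbit t ℓ U) × count U ≡ count (removeOrbit t ℓ U) + ℓ * m
    counted = removeOrbit-count t ℓ U uni present
      where
      present : ∀ i → i < ℓ → Occurs (removeOrbit t i U) (fold t Φ i)
      present i i<ℓ with B , inU , trB ← orbit-occurs clo occ i =
        B , member-removeOrbit t i U B inU
              (λ j j<i trB≡ → minimal-distinct minℓ j<i i<ℓ (trans (sym trB) trB≡)) , trB
    -- Φ t' lies on the cycle only if t' does, by injectivity of Φ
    closed : Closed (removeOrbit t ℓ U)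
    closed B inR with inU , avoids ← removeOrbit-member t ℓ U B inR
                 with B' , inU′ , trB' ← clo B inU =
      B' , member-removeOrbit t ℓ U B' inU′ avoids′ , trB'
      where
      avoids′ : AvoidsOrbit t ℓ B'
      avoids′ zero    _   onCycle =
        avoids (ℓ ∸ 1) (∸-monoʳ-< {o = 0} ≤-refl 1≤ℓ) (Φ-injective (trans (sym trB') (trans onCycle (sym period′))))
        where
        period′ : Φ (fold t Φ (ℓ ∸ 1)) ≡ t
        period′ = subst (λ z → fold t Φ z ≡ t) (sym (m+[n∸m]≡n 1≤ℓ)) period
      avoids′ (suc j) j<ℓ onCycle = avoids j (<⇒≤ j<ℓ) (Φ-injective (trans (sym trB') onCycle))

  OddOrbitIn : Blocks → Set
  OddOrbitIn U = ∃ λ B → U B ≡ true × ∃ λ c → Odd c × fold (tr B) Φ c ≡ tr B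

  -- By induction on k: the cycle through any trace of U is odd, or it can
  -- be removed, leaving (k - ℓ)·m blocks with k - ℓ odd.
  oddOrbit : ∀ k U → Odd k → count U ≡ k * m → Uniform U → Closed U → OddOrbitIn U
  oddOrbit = <-rec OddCase step
    where
    OddCase : ℕ → Set
    OddCase k = ∀ U → Odd k → count U ≡ k * m → Uniform U → Closed U → OddOrbitIn U

    k*m-positive : ∀ j → 1 ≤ suc (2 * j) * m
    k*m-positive j = *-mono-≤ {1} {suc (2 * j)} (s≤s z≤n) (>-nonZero⁻¹ m)

    step : ∀ k → (∀ {k'} → k' < k → OddCase k') → OddCase k
    step k smaller U k-odd@(j , refl) size uni clo
      with B₀ , inU ← count-nonzero U (subst (1 ≤_) (sym size) (k*m-positive j))
      with ℓ , minℓ@(1≤ℓ , period , _) ← minimalPeriod clo (B₀ , inU , refl)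
      with even-or-odd ℓ
    ... | inj₂ ℓ-odd  = B₀ , inU , ℓ , ℓ-odd , period
    ... | inj₁ ℓ-even
      with uni′ , clo′ , size′ ← removeCycle uni clo (B₀ , inU , refl) minℓ
      with ℓ≤k , size″ ← cancel-multiple _ ℓ k m (trans (sym size′) size)
      with B , inU′ , cycle ← smaller (∸-monoʳ-< {o = 0} 1≤ℓ ℓ≤k) _ (odd∸even k-odd ℓ-even ℓ≤k) size″ uni′ clo′
      = B , proj₁ (removeOrbit-member (tr B₀) ℓ U B inU′) , cycle

vec-ext : ∀ {A : Set} {n} {S T : Vec A n} → (∀ y → lookup S y ≡ lookup T y) → S ≡ T
vec-ext {S = S} {T} e = trans (sym (tabulate∘lookup S)) (trans (tabulate-cong e) (tabulate∘lookup T))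

module Actions {c ℓ : Level} {n : ℕ} {X : Group c ℓ} (α : Action X (Fin n)) where
  open Group X using (Carrier; _∙_; ε; _⁻¹; inverseˡ; inverseʳ)
  open Action α
  open import Algebra.Definitions.RawMonoid (Group.rawMonoid X) using () renaming (_×_ to _×ᵍ_)

  _^_ : Carrier → ℕ → Carrier
  g ^ c = c ×ᵍ g

  act-inverseˡ : ∀ g x → act (g ⁻¹) (act g x) ≡ x
  act-inverseˡ g x = trans (sym (act-∙ (g ⁻¹) g x)) (trans (act-cong (inverseˡ g) x) (act-ε x))

  act-inverseʳ : ∀ g y → act g (act (g ⁻¹) y) ≡ y
  act-inverseʳ g y = trans (sym (act-∙ g (g ⁻¹) y)) (trans (act-cong (inverseʳ g) y) (act-ε y))

  act-inverse-unique : ∀ g {x y} → act g x ≡ y → act (g ⁻¹) y ≡ x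
  act-inverse-unique g {x} refl = act-inverseˡ g x

  act-^ : ∀ g c x → act (g ^ c) x ≡ fold x (act g) c
  act-^ g zero    x = act-ε x
  act-^ g (suc c) x = trans (act-∙ g (g ^ c) x) (cong (act g) (act-^ g c x))

  lookup-img : ∀ g S y → lookup (img α g S) y ≡ lookup S (act (g ⁻¹) y)
  lookup-img g S y = lookup∘tabulate _ y

  lookup-img-act : ∀ g S x → lookup (img α g S) (act g x) ≡ lookup S x
  lookup-img-act g S x = trans (lookup-img g S (act g x)) (cong (lookup S) (act-inverseˡ g x))

  ∈-img : ∀ g {S x} → x ∈ S → act g x ∈ img α g S
  ∈-img g {S} {x} x∈S = lookup⇒[]= _ _ (trans (lookup-img-act g S x) ([]=⇒lookup x∈S))

  img-∈ : ∀ g {S y} → y ∈ img α g S → act (g ⁻¹) y ∈ S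
  img-∈ g {S} {y} y∈gS = lookup⇒[]= _ _ (trans (sym (lookup-img g S y)) ([]=⇒lookup y∈gS))

  img-cong : ∀ {g h} → (∀ x → act g x ≡ act h x) → ∀ S → img α g S ≡ img α h S
  img-cong {g} {h} same S = tabulate-cong λ y →
    cong (lookup S) (act-inverse-unique g (trans (same _) (act-inverseʳ h y)))

  img-∙ : ∀ g h S → img α (g ∙ h) S ≡ img α g (img α h S)
  img-∙ g h S = vec-ext λ y → begin
    lookup (img α (g ∙ h) S) y               ≡⟨ lookup-img (g ∙ h) S y ⟩
    lookup S (act ((g ∙ h) ⁻¹) y)            ≡⟨ cong (lookup S) (act-inverse-unique (g ∙ h) (undo y)) ⟩
    lookup S (act (h ⁻¹) (act (g ⁻¹) y))     ≡⟨ lookup-img h S _ ⟨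
    lookup (img α h S) (act (g ⁻¹) y)        ≡⟨ lookup-img g (img α h S) y ⟨
    lookup (img α g (img α h S)) y           ∎
    where
    open ≡-Reasoning
    undo : ∀ y → act (g ∙ h) (act (h ⁻¹) (act (g ⁻¹) y)) ≡ y
    undo y = trans (act-∙ g h _) (trans (cong (act g) (act-inverseʳ h _)) (act-inverseʳ g y))

  img-ε : ∀ S → img α ε S ≡ S
  img-ε S = vec-ext λ y → trans (lookup-img ε S y) (cong (lookup S) (act-inverse-unique ε (act-ε y)))

  img-injective : ∀ g {S T} → img α g S ≡ img α g T → S ≡ T
  img-injective g {S} {T} e = vec-ext λ x →
    trans (sym (lookup-img-act g S x)) (trans (cong (λ U → lookup U (act g x)) e) (lookup-img-act g T x))

  -- g preserves the size of subsets, as x ↦ g x is a permutation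
  ∣img∣ : ∀ g S → ∣ img α g S ∣ ≡ ∣ S ∣
  ∣img∣ g S = begin
    ∣ img α g S ∣                        ≡⟨ ∣tabulate∣ (lookup S ∘ act (g ⁻¹)) ⟩
    count (lookup S ∘ act (g ⁻¹))        ≡⟨ count-permute (lookup S) (act (g ⁻¹)) (act g) (act-inverseˡ g) (act-inverseʳ g) ⟩
    count (lookup S)                     ≡⟨ ∣tabulate∣ (lookup S) ⟨
    ∣ tabulate (lookup S) ∣              ≡⟨ cong ∣_∣ (tabulate∘lookup S) ⟩
    ∣ S ∣                                ∎
    where open ≡-Reasoning

  img-^ : ∀ g c S → img α (g ^ c) S ≡ fold S (img α g) c
  img-^ g zero    S = img-ε S
  img-^ g (suc c) S = trans (img-∙ g (g ^ c) S) (cong (img α g) (img-^ g c S))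

  starAct-∙ : ∀ g h s → starAct α (g ∙ h) s ≡ starAct α g (starAct α h s)
  starAct-∙ g h (star x S) = cong₂ star (act-∙ g h x) (img-∙ g h S)

  starAct-ε : ∀ s → starAct α ε s ≡ s
  starAct-ε (star x S) = cong₂ star (act-ε x) (img-ε S)

  starAct-inverseˡ : ∀ g s → starAct α (g ⁻¹) (starAct α g s) ≡ s
  starAct-inverseˡ g s@(star x S) = trans (sym (starAct-∙ (g ⁻¹) g s))
    (trans (cong₂ star (act-cong (inverseˡ g) x) (img-cong (act-cong (inverseˡ g)) S)) (starAct-ε s))

  dsAct-∙ : ∀ g h d → dsAct α (g ∙ h) d ≡ dsAct α g (dsAct α h d)
  dsAct-∙ g h (dstar l r) = cong₂ dstar (starAct-∙ g h l) (starAct-∙ g h r)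

  dsAct-ε : ∀ d → dsAct α ε d ≡ d
  dsAct-ε (dstar l r) = cong₂ dstar (starAct-ε l) (starAct-ε r)

  starAct-^-twice : ∀ g c s → starAct α (g ^ c) (starAct α (g ^ c) s) ≡ starAct α ((g ∙ g) ^ c) s
  starAct-^-twice g c s = trans (sym (starAct-∙ (g ^ c) (g ^ c) s))
    (cong₂ star (twice (Star.centre s)) (img-cong twice (Star.leaves s)))
    where
    twice : ∀ x → act (g ^ c ∙ g ^ c) x ≡ act ((g ∙ g) ^ c) x
    twice x = begin
      act (g ^ c ∙ g ^ c) x                  ≡⟨ act-∙ (g ^ c) (g ^ c) x ⟩
      act (g ^ c) (act (g ^ c) x)            ≡⟨ act-^ g c _ ⟩
      fold (act (g ^ c) x) (act g) c         ≡⟨ cong (λ y → fold y (act g) c) (act-^ g c x) ⟩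
      fold (fold x (act g) c) (act g) c      ≡⟨ fold-twice (act g) x c ⟨
      fold x (act g ∘ act g) c               ≡⟨ fold-cong (λ y → sym (act-∙ g g y)) x c ⟩
      fold x (act (g ∙ g)) c                 ≡⟨ act-^ (g ∙ g) c x ⟨
      act ((g ∙ g) ^ c) x                    ∎
      where open ≡-Reasoning

  act-square-swap : ∀ g {x y} → act g x ≡ y → act g y ≡ x → act (g ∙ g) x ≡ x
  act-square-swap g {x} gx gy = trans (act-∙ g g x) (trans (cong (act g) gx) gy)

  act-^-odd-swap : ∀ g {x y} → act g x ≡ y → act g y ≡ x → ∀ c → Odd c → act (g ^ c) x ≡ y
  act-^-odd-swap g gx gy c c-odd = trans (act-^ g c _) (fold-odd-swap (act g) gx gy c c-odd)

  starAct-^-fixed : ∀ g c {x S} → act g x ≡ x → fold S (img α g) c ≡ S →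
                    starAct α (g ^ c) (star x S) ≡ star x S
  starAct-^-fixed g c gx gS =
    cong₂ star (trans (act-^ g c _) (fold-fixed (act g) gx c)) (trans (img-^ g c _) gS)

-- Double stars (s, h s) for an element h with h (h s) = s.  Such an h maps
-- the double star to its reverse, and every star of its X-orbit is an
-- image of s; this gives self-pairedness and X-symmetry.
module ReversedDoubleStars {c ℓ : Level} {n : ℕ} {X : Group c ℓ} (α : Action X (Fin n)) where
  open Group X using (Carrier; _∙_; ε; _⁻¹)
  open Actions α

  pairWith : Carrier → Star n → DoubleStar n
  pairWith h s = dstar s (starAct α h s)

  Reverses : Carrier → Star n → Set
  Reverses h s = starAct α h (starAct α h s) ≡ s

  reversed : ∀ h s → Reverses h s → dsAct α h (pairWith h s) ≡ swapDS (pairWith h s)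
  reversed h s hhs = cong₂ dstar refl hhs

  selfPaired : ∀ h s → Reverses h s → IsSelfPairedOrbit α (pairWith h s)
  selfPaired h s hhs _ (g , refl) =
    g ∙ h , trans (dsAct-∙ g h (pairWith h s)) (cong (dsAct α g) (reversed h s hhs))

  orbitStar-image : ∀ h s {s'} → StarsOfOrbit α (pairWith h s) s' → ∃ λ a → starAct α a s ≡ s'
  orbitStar-image h s (_ , (g , refl) , inj₁ refl) = g , refl
  orbitStar-image h s (_ , (g , refl) , inj₂ refl) = g ∙ h , starAct-∙ g h s

  xSymmetric : ∀ h s → IsSymmetricStar α s → IsXSymmetricOrbit α (pairWith h s)
  xSymmetric h s s-sym = closed , transitive , (s , (pairWith h s , (ε , dsAct-ε _) , inj₁ refl) , s-sym)
    where
    closed : ∀ s' → StarsOfOrbit α (pairWith h s) s' → ∀ g → StarsOfOrbit α (pairWith h s) (starAct α g s')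
    closed s' (_ , (g' , refl) , side) g =
      dsAct α g (dsAct α g' (pairWith h s)) , (g ∙ g' , dsAct-∙ g g' (pairWith h s)) ,
      ⊎-map (cong (starAct α g)) (cong (starAct α g)) side
    transitive : ∀ s₁ s₂ → StarsOfOrbit α (pairWith h s) s₁ → StarsOfOrbit α (pairWith h s) s₂ →
                 ∃ λ g → starAct α g s₁ ≡ s₂
    transitive s₁ s₂ o₁ o₂ with a₁ , refl ← orbitStar-image h s o₁ | a₂ , refl ← orbitStar-image h s o₂ =
      a₂ ∙ a₁ ⁻¹ , trans (starAct-∙ a₂ (a₁ ⁻¹) (starAct α a₁ s)) (cong (starAct α a₂) (starAct-inverseˡ a₁ s))

module Neighbourhoods {n : ℕ} (Γ : Graph n) where
  open Graph Γ using (adj; nbhd; HasValency)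

  ∈-nbhd : ∀ {x y} → y ∈ nbhd x → adj x y ≡ true
  ∈-nbhd {x} {y} y∈ = trans (sym (lookup∘tabulate (adj x) y)) ([]=⇒lookup y∈)

  nbhd-∈ : ∀ {x y} → adj x y ≡ true → y ∈ nbhd x
  nbhd-∈ {x} {y} xy = lookup⇒[]= y (nbhd x) (trans (lookup∘tabulate (adj x) y) xy)

  neighbour : ∀ {v} → HasValency v → 1 ≤ v → ∀ x → ∃ λ y → y ∈ nbhd x
  neighbour valency 1≤v x with nonempty? (nbhd x)
  ... | yes nonempty = nonempty
  ... | no  empty    = contradiction (trans (sym (valency x)) (trans (cong ∣_∣ (Empty-unique empty)) (∣⊥∣≡0 n)))
                                     (>⇒≢ 1≤v)

module SymmetricGraph {c ℓ : Level} {n : ℕ} (Γ : Graph n) {X : Group c ℓ} {α : Action X (Fin n)}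
                      (symmetric : IsSymmetric Γ X α) where
  open Graph Γ using (adj; nbhd)
  open Group X using (_⁻¹)
  open Action α
  open IsSymmetric symmetric
  open Neighbourhoods Γ
  open Actions α
  open ReversedDoubleStars α

  starAct-KStar : ∀ κ g s → IsKStar Γ κ s → IsKStar Γ κ (starAct α g s)
  starAct-KStar κ g (star x S) (S⊆Σx , ∣S∣) = gS⊆Σgx , trans (∣img∣ g S) ∣S∣
    where
    gS⊆Σgx : img α g S ⊆ nbhd (act g x)
    gS⊆Σgx {y} y∈gS = nbhd-∈ (begin
      adj (act g x) y                        ≡⟨ cong (adj (act g x)) (act-inverseʳ g y) ⟨
      adj (act g x) (act g (act (g ⁻¹) y))   ≡⟨ preserves-adj g x _ ⟩
      adj x (act (g ⁻¹) y)                   ≡⟨ ∈-nbhd (S⊆Σx (img-∈ g y∈gS)) ⟩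
      true                                   ∎)
      where open ≡-Reasoning

  arc-reversal : ∀ {x y} → y ∈ nbhd x → ∃ λ g → act g x ≡ y × act g y ≡ x
  arc-reversal {x} {y} y∈Σx = arc-trans x y y x xy (trans (Graph.sym Γ y x) xy)
    where
    xy : adj x y ≡ true
    xy = ∈-nbhd y∈Σx

  -- (s(τ,L), h s(τ,L)) is a κ-double star: h τ ∈ L, and τ = h (h τ) ∈ h L
  pairWith-KDoubleStar : ∀ κ h τ L → IsKStar Γ κ (star τ L) → act h τ ∈ L → Reverses h (star τ L) →
                         IsKDoubleStar Γ κ (pairWith h (star τ L))
  pairWith-KDoubleStar κ h τ L kstar hτ∈L hhs =
    kstar , starAct-KStar κ h (star τ L) kstar , hτ∈L , subst (_∈ img α h L) (cong Star.centre hhs) (∈-img h hτ∈L)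

module FlagTransitiveDesign {c ℓ : Level} {n : ℕ} {Γ : Graph n} {X : Group c ℓ} {α : Action X (Fin n)}
                            {τ : Fin n} {v κ ρ : ℕ} (D : FlagTransDesign Γ X α τ v κ ρ) where
  open Graph Γ using (nbhd)
  open Group X using (_∙_; _⁻¹; inverseˡ)
  open Action α
  open FlagTransDesign D
  open Actions α

  bact-inverseˡ : ∀ g (p : act g τ ≡ τ) (q : act (g ⁻¹) τ ≡ τ) B → bact (g ⁻¹) q (bact g p B) ≡ B
  bact-inverseˡ g p q B =
    trans (sym (bact-∙ (g ⁻¹) g r q p B)) (trans (bact-cong r (act-ε τ) (inverseˡ g) B) (bact-ε (act-ε τ) B))
    where
    r : act (g ⁻¹ ∙ g) τ ≡ τ
    r = trans (act-∙ (g ⁻¹) g τ) (trans (cong (act (g ⁻¹)) p) q)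

  inc-bact : ∀ g (p : act g τ ≡ τ) B → inc (bact g p B) ≡ img α g (inc B)
  inc-bact g p B = ⊆-antisym ⊆img img⊆
    where
    q : act (g ⁻¹) τ ≡ τ
    q = act-inverse-unique g p
    ⊆img : inc (bact g p B) ⊆ img α g (inc B)
    ⊆img {y} y∈ = subst (_∈ img α g (inc B)) (act-inverseʳ g y)
      (∈-img g (subst (λ B' → act (g ⁻¹) y ∈ inc B') (bact-inverseˡ g p q B) (bact-inc (g ⁻¹) q y _ y∈)))
    img⊆ : img α g (inc B) ⊆ inc (bact g p B)
    img⊆ {y} y∈ = subst (_∈ inc (bact g p B)) (act-inverseʳ g y) (bact-inc g p _ B (img-∈ g y∈))

  blockStar-symmetric : ∀ B → IsSymmetricStar α (star τ (inc B))
  blockStar-symmetric B x y x∈ y∈ with g , p , gx , gB ← flag-trans x B y B x∈ y∈ =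
    g , p , trans (sym (inc-bact g p B)) (cong inc gB) , gx

  through : Fin n → Fin b → Bool
  through σ B = does (σ ∈? inc B)

  through-∈ : ∀ σ B → through σ B ≡ true → σ ∈ inc B
  through-∈ σ B e with σ ∈? inc B
  ... | yes σ∈B = σ∈B

  ∈-through : ∀ σ B → σ ∈ inc B → through σ B ≡ true
  ∈-through σ B σ∈B with σ ∈? inc B
  ... | yes _   = refl
  ... | no  σ∉B = contradiction σ∈B σ∉B

  oddTraceOrbit : ∀ {σ} → σ ∈ nbhd τ → ∀ f → act f τ ≡ τ → act f σ ≡ σ →
                  ∀ m .{{_ : NonZero m}} → HasMultiplicity m → ∀ k → ρ ≡ k * m → Odd k →
                  ∃ λ B → σ ∈ inc B × ∃ λ c → Odd c × fold (inc B) (img α f) c ≡ inc B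
  oddTraceOrbit {σ} σ∈Στ f fτ fσ m multiplicity k ρ≡km k-odd =
    let B , B-through-σ , cycle = oddOrbit k (through σ) k-odd size uniform closed
    in  B , through-∈ σ B B-through-σ , cycle
    where
    open OddOrbit (≡-dec _≟ᵇ_) (img α f) (img-injective f) inc m
    size : count (through σ) ≡ k * m
    size = trans (sym (∣tabulate∣ (through σ))) (trans (replication σ σ∈Στ) ρ≡km)
    -- a trace through σ is carried by exactly m blocks, all through σ
    uniform : Uniform (through σ)
    uniform B inU = trans (count-cong sameClass) (trans (sym (∣tabulate∣ (withTrace (inc B)))) (multiplicity B))
      where
      sameClass : ∀ B' → through σ B' ∧ withTrace (inc B) B' ≡ withTrace (inc B) B'
      sameClass B' with withTrace (inc B) B' in w
      ... | false = ∧-zeroʳ _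
      ... | true  = trans (∧-identityʳ _) (trans (cong (λ S → does (σ ∈? S)) (withTrace-≡ (inc B) B' w)) inU)
    -- f permutes the blocks through σ, acting on their traces by img f
    closed : Closed (through σ)
    closed B inU = bact f fτ B ,
      ∈-through σ _ (subst (_∈ inc (bact f fτ B)) fσ (bact-inc f fτ σ B (through-∈ σ B inU))) , inc-bact f fτ B

theorem3p6 : ∀ {c ℓ : Level} {n : ℕ} (Γ : Graph n) (X : Group c ℓ)
    (α : Action X (Fin n)) → IsSymmetric Γ X α →
    (v : ℕ) → Graph.HasValency Γ v → 2 ≤ v → (τ : Fin n) →
    (κ ρ : ℕ) → 1 ≤ κ → κ ≤ v ∸ 1 →
    (D : FlagTransDesign Γ X α τ v κ ρ) →
    (m : ℕ) → FlagTransDesign.HasMultiplicity D m → 1 ≤ m →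
    (∃ λ k → ρ ≡ k * m × Odd k) →
    ∃ λ d₀ → IsKDoubleStar Γ κ d₀ ×
      IsSelfPairedOrbit α d₀ × IsXSymmetricOrbit α d₀
theorem3p6 Γ X α symmetric v valency 2≤v τ κ ρ _ _ D m multiplicity 1≤m (k , ρ≡km , k-odd) =
  let
      σ , σ∈Στ    = neighbour valency (≤-trans (s≤s z≤n) 2≤v) τ
      g , gτ , gσ = arc-reversal σ∈Στ
      -- g ∙ g fixes τ and σ, so it has an odd orbit on the traces through σ
      B , σ∈B , c , c-odd , cycle =
        oddTraceOrbit σ∈Στ (g ∙ g) (act-square-swap g gτ gσ) (act-square-swap g gσ gτ)
                      m {{>-nonZero 1≤m}} multiplicity k ρ≡km k-odd
      -- h = g ^ c exchanges τ and σ, and h ∙ h = (g ∙ g) ^ c fixes s(τ, inc B)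
      h  = g ^ c
      s₀ = star τ (inc B)
      hτ∈B : act h τ ∈ inc B
      hτ∈B = subst (_∈ inc B) (sym (act-^-odd-swap g gτ gσ c c-odd)) σ∈B
      reverses : Reverses h s₀
      reverses = trans (starAct-^-twice g c s₀) (starAct-^-fixed (g ∙ g) c (act-square-swap g gτ gσ) cycle)
  in pairWith h s₀ , pairWith-KDoubleStar κ h τ (inc B) (on-points B , block-size B) hτ∈B reverses ,
     selfPaired h s₀ reverses , xSymmetric h s₀ (blockStar-symmetric B)
  where
  open Group X using (_∙_)
  open Action α using (act)
  open FlagTransDesign D using (inc; on-points; block-size)
  open Neighbourhoods Γ using (neighbour)
  open Actions α
  open ReversedDoubleStars α
  open SymmetricGraph Γ symmetric
  open FlagTransitiveDesign D using (blockStar-symmetric; oddTraceOrbit)
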